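{- Assume the Axiom of Choice. (i) There exist regular total orderings of $Sen(L)$. (ii) Moreover, for every set $A\subseteq Sen(L)$ of pairwise classically inequivalent sentences and every partial ordering $R$ of $A$, there is a regular total ordering $<$ of $Sen(L)$ with $R\subseteq\,<$.
   Context: $L$ is the classical propositional language with atoms $p_0,p_1,\ldots$ and connectives $\neg,\wedge$; $Sen(L)$ is its set of sentences, $\sim$ is classical logical equivalence, and $[\alpha]=\{\beta:\beta\sim\alpha\}$. A total ordering $<$ of $Sen(L)$ is regular if for all $\alpha,\beta$ with $\alpha\not\sim\beta$ and $\alpha<\beta$ we have $[\alpha]<[\beta]$, i.e. $\alpha'<\beta'$ for all $\alpha'\in[\alpha]$, $\beta'\in[\beta]$. -}

module Defs where

open import Data.Nat using (ℕ)
open import Data.Bool using (Bool; not; _∧_)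
open import Data.Product using (_×_; Σ)
open import Relation.Binary.PropositionalEquality using (_≡_; _≢_)
open import Relation.Binary.Structures using (IsStrictTotalOrder)
open import Relation.Nullary using (¬_)

data Sen : Set where
  atom : ℕ → Sen
  neg  : Sen → Sen
  conj : Sen → Sen → Sen

Valuation : Set
Valuation = ℕ → Bool

eval : Valuation → Sen → Bool
eval v (atom n)   = v n
eval v (neg α)    = not (eval v α)
eval v (conj α β) = eval v α ∧ eval v β

_∼_ : Sen → Sen → Set
α ∼ β = ∀ (v : Valuation) → eval v α ≡ eval v β

IsTotalOrdering : (Sen → Sen → Set) → Set
IsTotalOrdering _<_ = IsStrictTotalOrder _≡_ _<_

IsRegular : (Sen → Sen → Set) → Set
IsRegular _<_ = ∀ α β → ¬ (α ∼ β) → α < β →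
  ∀ α′ β′ → α′ ∼ α → β′ ∼ β → α′ < β′

IsRegularTotalOrdering : (Sen → Sen → Set) → Set
IsRegularTotalOrdering _<_ = IsTotalOrdering _<_ × IsRegular _<_

PairwiseInequivalent : (Sen → Set) → Set
PairwiseInequivalent A = ∀ α β → A α → A β → α ≢ β → ¬ (α ∼ β)

IsPartialOrderingOf : (Sen → Set) → (Sen → Sen → Set) → Set
IsPartialOrderingOf A R =
  (∀ α β → R α β → A α × A β) ×
  (∀ α → ¬ R α α) ×
  (∀ α β γ → R α β → R β γ → R α γ)

-- Code sentences injectively by natural numbers. A partial order ⊑ on sentences
-- modulo ∼ (∼ itself for (i); for (ii) the closure of R under ∼) is linearised by
-- comparing down-sets: ↓ α is the set of codes of the sentences ⊑ α, and down-sets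
-- are ordered lexicographically as 0-1 sequences, which excluded middle makes total.
-- Antisymmetry makes ↓ injective on ∼-classes, so distinct classes are strictly
-- ordered and ties inside a class are broken by the codes. Since ↓ α depends only on
-- the class of α the result is regular, and it extends ⊑ because α ⊑ β, α ≁ β gives
-- ↓ α ⊊ ↓ β.
module Submission where

open import Defs
open import Level using (0ℓ)
open import Axiom.ExcludedMiddle using (ExcludedMiddle)
open import Axiom.DoubleNegationElimination using (em⇒dne)
open import Data.Product using (Σ; ∃; ∃₂; _×_; _,_; proj₁; proj₂; map₂)
open import Data.Sum using (_⊎_; inj₁; inj₂)
open import Data.Empty using (⊥-elim)
open import Data.Nat using (ℕ; zero; suc; _+_; _≤_; _<_; z≤n; s≤s)
open import Data.Nat.Properties
open import Data.Nat.Induction using (<-rec)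
open import Function using (id; _∘_; const)
open import Function.Bundles using (_⇔_; mk⇔; Equivalence)
open import Function.Definitions using (Injective)
open import Function.Properties.Equivalence using (⇔-isEquivalence)
open import Relation.Nullary using (¬_; yes; no; contradiction)
open import Relation.Unary using (Pred; _∈_; _∉_; _⊆_; _≐_)
open import Relation.Unary.Properties using (≐-refl)
open import Relation.Binary using (Rel; Setoid; IsEquivalence; IsPartialOrder;
  IsStrictTotalOrder; tri<; tri≈; tri>; Trichotomous)
open import Relation.Binary.PropositionalEquality using (_≡_; refl; cong; cong₂)
import Relation.Binary.PropositionalEquality as ≡
import Relation.Binary.Properties.Setoid as SetoidProperties

module ⇔ {ℓ} = IsEquivalence (⇔-isEquivalence {ℓ})

triangle : ℕ → ℕ
triangle zero    = 0
triangle (suc n) = triangle n + suc n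

triangle-mono-≤ : ∀ {m n} → m ≤ n → triangle m ≤ triangle n
triangle-mono-≤ z≤n       = z≤n
triangle-mono-≤ (s≤s m≤n) = +-mono-≤ (triangle-mono-≤ m≤n) (s≤s m≤n)

triangle+offset-< : ∀ {s s′ b b′} → s < s′ → b ≤ s →
                    triangle s + b < triangle s′ + b′
triangle+offset-< {s} {s′} {b} {b′} s<s′ b≤s = begin-strict
  triangle s + b     <⟨ +-monoʳ-< (triangle s) (s≤s b≤s) ⟩
  triangle (suc s)   ≤⟨ triangle-mono-≤ s<s′ ⟩
  triangle s′        ≤⟨ m≤m+n (triangle s′) b′ ⟩
  triangle s′ + b′   ∎
  where open ≤-Reasoning

triangle+offset-injectiveˡ : ∀ {s s′ b b′} → b ≤ s → b′ ≤ s′ →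
                             triangle s + b ≡ triangle s′ + b′ → s ≡ s′
triangle+offset-injectiveˡ {s} {s′} b≤s b′≤s′ eq with <-cmp s s′
... | tri< s<s′ _ _ = contradiction eq (<⇒≢ (triangle+offset-< s<s′ b≤s))
... | tri≈ _ s≡s′ _ = s≡s′
... | tri> _ _ s>s′ = contradiction eq (>⇒≢ (triangle+offset-< s>s′ b′≤s′))

pair : ℕ → ℕ → ℕ
pair a b = triangle (a + b) + b

pair-injective : ∀ a b a′ b′ → pair a b ≡ pair a′ b′ → a ≡ a′ × b ≡ b′
pair-injective a b a′ b′ eq = a≡a′ , b≡b′
  where
  sums : a + b ≡ a′ + b′
  sums = triangle+offset-injectiveˡ (m≤n+m b a) (m≤n+m b′ a′) eq
  b≡b′ : b ≡ b′
  b≡b′ = +-cancelˡ-≡ (triangle (a + b)) b b′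
           (≡.trans eq (cong (λ s → triangle s + b′) (≡.sym sums)))
  a≡a′ : a ≡ a′
  a≡a′ = +-cancelʳ-≡ b a a′ (≡.trans sums (cong (a′ +_) (≡.sym b≡b′)))

mutual
  encode : Sen → ℕ
  encode α = pair (tag α) (body α)

  tag : Sen → ℕ
  tag (atom _)   = 0
  tag (neg _)    = 1
  tag (conj α _) = 2 + encode α

  body : Sen → ℕ
  body (atom n)   = n
  body (neg α)    = encode α
  body (conj _ β) = encode β

encode-injective : Injective _≡_ _≡_ encode
encode-injective {α} {β} eq =
  tag-body-injective α β (pair-injective (tag α) (body α) (tag β) (body β) eq)
  where
  tag-body-injective : ∀ α β → tag α ≡ tag β × body α ≡ body β → α ≡ β
  tag-body-injective (atom _)   (atom _)   (_ , eq)     = cong atom eq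
  tag-body-injective (neg _)    (neg _)    (_ , eq)     = cong neg (encode-injective eq)
  tag-body-injective (conj _ _) (conj _ _) (eq₁ , eq₂)  =
    cong₂ conj (encode-injective (+-cancelˡ-≡ 2 _ _ eq₁)) (encode-injective eq₂)
  tag-body-injective (atom _)   (neg _)    (() , _)
  tag-body-injective (atom _)   (conj _ _) (() , _)
  tag-body-injective (neg _)    (atom _)   (() , _)
  tag-body-injective (neg _)    (conj _ _) (() , _)
  tag-body-injective (conj _ _) (atom _)   (() , _)
  tag-body-injective (conj _ _) (neg _)    (() , _)

infix 4 _<ₗₑₓ_

_<ₗₑₓ_ : Pred ℕ 0ℓ → Pred ℕ 0ℓ → Set
S <ₗₑₓ U = ∃ λ m → m ∉ S × m ∈ U × (∀ {k} → k < m → S k ⇔ U k)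

≐⇒⇔ : ∀ {S U : Pred ℕ 0ℓ} {k} → S ≐ U → S k ⇔ U k
≐⇒⇔ (S⊆U , U⊆S) = mk⇔ S⊆U U⊆S

<ₗₑₓ-resp-≐ : ∀ {S S′ U U′} → S ≐ S′ → U ≐ U′ → S <ₗₑₓ U → S′ <ₗₑₓ U′
<ₗₑₓ-resp-≐ S≐S′ U≐U′ (m , m∉S , m∈U , agree) =
  m , m∉S ∘ proj₂ S≐S′ , proj₁ U≐U′ m∈U ,
  λ k<m → ⇔.trans (⇔.sym (≐⇒⇔ S≐S′)) (⇔.trans (agree k<m) (≐⇒⇔ U≐U′))

<ₗₑₓ-irrefl : ∀ {S U} → S ≐ U → ¬ S <ₗₑₓ U
<ₗₑₓ-irrefl (_ , U⊆S) (_ , m∉S , m∈U , _) = m∉S (U⊆S m∈U)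

<ₗₑₓ-trans : ∀ {S U V} → S <ₗₑₓ U → U <ₗₑₓ V → S <ₗₑₓ V
<ₗₑₓ-trans (m , m∉S , m∈U , S⇔U) (n , n∉U , n∈V , U⇔V) with <-cmp m n
... | tri< m<n _ _ = m , m∉S , Equivalence.to (U⇔V m<n) m∈U ,
                     λ k<m → ⇔.trans (S⇔U k<m) (U⇔V (<-trans k<m m<n))
... | tri≈ _ refl _ = m , m∉S , n∈V , λ k<m → ⇔.trans (S⇔U k<m) (U⇔V k<m)
... | tri> _ _ m>n = n , n∉U ∘ Equivalence.to (S⇔U m>n) , n∈V ,
                     λ k<n → ⇔.trans (S⇔U (<-trans k<n m>n)) (U⇔V k<n)

<ₗₑₓ-asym : ∀ {S U} → S <ₗₑₓ U → ¬ U <ₗₑₓ S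
<ₗₑₓ-asym S<U U<S = <ₗₑₓ-irrefl ≐-refl (<ₗₑₓ-trans S<U U<S)

Least : Pred ℕ 0ℓ → Set
Least P = ∃ λ m → P m × (∀ {k} → k < m → ¬ P k)

module Classical (lem : ExcludedMiddle 0ℓ) where

  dne : ∀ {P : Set} → ¬ ¬ P → P
  dne = em⇒dne lem

  least-witness : (P : Pred ℕ 0ℓ) → ∀ {n} → P n → Least P
  least-witness P {n} = <-rec (λ n → P n → Least P) step n
    where
    step : ∀ n → (∀ {k} → k < n → P k → Least P) → P n → Least P
    step n below pn with lem {∃ λ k → k < n × P k}
    ... | yes (k , k<n , pk) = below k<n pk
    ... | no none           = n , pn , λ k<n pk → none (_ , k<n , pk)

  <ₗₑₓ-total : ∀ {S U} → ¬ S ≐ U → S <ₗₑₓ U ⊎ U <ₗₑₓ S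
  <ₗₑₓ-total {S} {U} S≉U with least-witness (λ k → ¬ (S k ⇔ U k)) (proj₂ some-difference)
    where
    some-difference : ∃ λ k → ¬ (S k ⇔ U k)
    some-difference = dne λ none →
      S≉U ((λ {k} → Equivalence.to (dne (none ∘ (k ,_))))
          , (λ {k} → Equivalence.from (dne (none ∘ (k ,_)))))
  ... | m , differ , agree-below with lem {S m}
  ...   | yes m∈S = inj₂ (m , (λ m∈U → differ (mk⇔ (const m∈U) (const m∈S))) , m∈S ,
                          ⇔.sym ∘ dne ∘ agree-below)
  ...   | no m∉S  = inj₁ (m , m∉S ,
                          dne (λ m∉U → differ (mk⇔ (⊥-elim ∘ m∉S) (⊥-elim ∘ m∉U))) ,
                          dne ∘ agree-below)

  ⊂⇒<ₗₑₓ : ∀ {S U m} → S ⊆ U → m ∉ S → m ∈ U → S <ₗₑₓ U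
  ⊂⇒<ₗₑₓ {S} {U} S⊆U m∉S m∈U with least-witness (λ k → k ∉ S × k ∈ U) (m∉S , m∈U)
  ... | k , (k∉S , k∈U) , minimal =
    k , k∉S , k∈U , λ j<k → mk⇔ S⊆U (λ j∈U → dne λ j∉S → minimal j<k (j∉S , j∈U))

module LinearExtension
  (lem : ExcludedMiddle 0ℓ)
  {X : Set} {code : X → ℕ} (code-injective : Injective _≡_ _≡_ code)
  {_≈_ _⊑_ : Rel X 0ℓ} (isPartialOrder : IsPartialOrder _≈_ _⊑_)
  where

  open Classical lem
  open IsPartialOrder isPartialOrder using (module Eq; reflexive; antisym)
    renaming (trans to ⊑-trans)

  ↓_ : X → Pred ℕ 0ℓ
  (↓ α) n = ∃ λ γ → code γ ≡ n × γ ⊑ α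

  ↓-self : ∀ {α} → code α ∈ ↓ α
  ↓-self {α} = α , refl , reflexive Eq.refl

  ↓-reflects : ∀ {γ α} → code γ ∈ ↓ α → γ ⊑ α
  ↓-reflects (_ , eq , γ′⊑α) with code-injective eq
  ... | refl = γ′⊑α

  ↓-mono : ∀ {α β} → α ⊑ β → ↓ α ⊆ ↓ β
  ↓-mono α⊑β (γ , eq , γ⊑α) = γ , eq , ⊑-trans γ⊑α α⊑β

  ↓-resp-≈ : ∀ {α β} → α ≈ β → ↓ α ≐ ↓ β
  ↓-resp-≈ α≈β = ↓-mono (reflexive α≈β) , ↓-mono (reflexive (Eq.sym α≈β))

  ↓-injective : ∀ {α β} → ↓ α ≐ ↓ β → α ≈ β
  ↓-injective (↓α⊆↓β , ↓β⊆↓α) =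
    antisym (↓-reflects (↓α⊆↓β ↓-self)) (↓-reflects (↓β⊆↓α ↓-self))

  ↓-strictMono : ∀ {α β} → α ⊑ β → ¬ α ≈ β → ↓ α <ₗₑₓ ↓ β
  ↓-strictMono α⊑β α≉β =
    ⊂⇒<ₗₑₓ (↓-mono α⊑β) (λ β∈↓α → α≉β (antisym α⊑β (↓-reflects β∈↓α))) ↓-self

  infix 4 _≺_

  _≺_ : Rel X 0ℓ
  α ≺ β = ↓ α <ₗₑₓ ↓ β ⊎ (α ≈ β × code α < code β)

  ≺-inequivalent : ∀ {α β} → ¬ α ≈ β → α ≺ β → ↓ α <ₗₑₓ ↓ β
  ≺-inequivalent _   (inj₁ α<β)      = α<β
  ≺-inequivalent α≉β (inj₂ (α≈β , _)) = contradiction α≈β α≉β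

  ≺-equivalent : ∀ {α β} → α ≈ β → α ≺ β → code α < code β
  ≺-equivalent α≈β (inj₁ α<β)      = contradiction α<β (<ₗₑₓ-irrefl (↓-resp-≈ α≈β))
  ≺-equivalent _   (inj₂ (_ , α<β)) = α<β

  ≺-irrefl : ∀ {α β} → α ≡ β → ¬ α ≺ β
  ≺-irrefl refl = <-irrefl refl ∘ ≺-equivalent Eq.refl

  ≺-trans : ∀ {α β γ} → α ≺ β → β ≺ γ → α ≺ γ
  ≺-trans (inj₁ α<β)        (inj₁ β<γ)        = inj₁ (<ₗₑₓ-trans α<β β<γ)
  ≺-trans (inj₁ α<β)        (inj₂ (β≈γ , _))   =
    inj₁ (<ₗₑₓ-resp-≐ ≐-refl (↓-resp-≈ β≈γ) α<β)
  ≺-trans (inj₂ (α≈β , _))   (inj₁ β<γ)        =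
    inj₁ (<ₗₑₓ-resp-≐ (↓-resp-≈ (Eq.sym α≈β)) ≐-refl β<γ)
  ≺-trans (inj₂ (α≈β , α<β)) (inj₂ (β≈γ , β<γ)) = inj₂ (Eq.trans α≈β β≈γ , <-trans α<β β<γ)

  ≺-compare : Trichotomous _≡_ _≺_
  ≺-compare α β with lem {α ≈ β}
  ... | no α≉β with <ₗₑₓ-total (α≉β ∘ ↓-injective)
  ...   | inj₁ α<β = tri< (inj₁ α<β) (λ { refl → α≉β Eq.refl })
                          (<ₗₑₓ-asym α<β ∘ ≺-inequivalent (α≉β ∘ Eq.sym))
  ...   | inj₂ β<α = tri> (<ₗₑₓ-asym β<α ∘ ≺-inequivalent α≉β)
                          (λ { refl → α≉β Eq.refl }) (inj₁ β<α)
  ≺-compare α β | yes α≈β with <-cmp (code α) (code β)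
  ...   | tri< α<β α≢β α≯β =
    tri< (inj₂ (α≈β , α<β)) (α≢β ∘ cong code) (α≯β ∘ ≺-equivalent (Eq.sym α≈β))
  ...   | tri≈ _ α≡β _ =
    tri≈ (≺-irrefl (code-injective α≡β)) (code-injective α≡β)
         (≺-irrefl (≡.sym (code-injective α≡β)))
  ...   | tri> α≮β α≢β α>β =
    tri> (α≮β ∘ ≺-equivalent α≈β) (α≢β ∘ cong code) (inj₂ (Eq.sym α≈β , α>β))

  ≺-isStrictTotalOrder : IsStrictTotalOrder _≡_ _≺_
  ≺-isStrictTotalOrder = record
    { isStrictPartialOrder = record
      { isEquivalence = ≡.isEquivalence
      ; irrefl        = ≺-irrefl
      ; trans         = ≺-trans
      ; <-resp-≈      = (λ { refl → id }) , (λ { refl → id })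
      }
    ; compare = ≺-compare
    }

  ≺-regular : ∀ α β → ¬ α ≈ β → α ≺ β → ∀ α′ β′ → α′ ≈ α → β′ ≈ β → α′ ≺ β′
  ≺-regular _ _ α≉β α≺β _ _ α′≈α β′≈β = inj₁
    (<ₗₑₓ-resp-≐ (↓-resp-≈ (Eq.sym α′≈α)) (↓-resp-≈ (Eq.sym β′≈β)) (≺-inequivalent α≉β α≺β))

  ⊏⇒≺ : ∀ {α β} → α ⊑ β → ¬ α ≈ β → α ≺ β
  ⊏⇒≺ α⊑β α≉β = inj₁ (↓-strictMono α⊑β α≉β)

module ClosureUnderEquivalence
  {X : Set} {_≈_ : Rel X 0ℓ} (≈-isEquivalence : IsEquivalence _≈_)
  (A : Pred X 0ℓ) (≈⇒≡-on-A : ∀ {a b} → A a → A b → a ≈ b → a ≡ b)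
  (R : Rel X 0ℓ)
  (R-domain : ∀ a b → R a b → A a × A b)
  (R-irrefl : ∀ a → ¬ R a a)
  (R-trans : ∀ a b c → R a b → R b c → R a c)
  where

  open IsEquivalence ≈-isEquivalence
    using () renaming (refl to ≈-refl; sym to ≈-sym; trans to ≈-trans)

  R-trans-≈ : ∀ {a b b′ c} → R a b → b ≈ b′ → R b′ c → R a c
  R-trans-≈ {a} {b} {b′} {c} aRb b≈b′ b′Rc
    with ≈⇒≡-on-A (proj₂ (R-domain a b aRb)) (proj₁ (R-domain b′ c b′Rc)) b≈b′
  ... | refl = R-trans a b c aRb b′Rc

  R⇒≉ : ∀ {a b} → R a b → ¬ a ≈ b
  R⇒≉ {a} {b} aRb a≈b with ≈⇒≡-on-A (proj₁ (R-domain a b aRb)) (proj₂ (R-domain a b aRb)) a≈b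
  ... | refl = R-irrefl a aRb

  infix 4 _≤ᴿ_

  _≤ᴿ_ : Rel X 0ℓ
  γ ≤ᴿ α = γ ≈ α ⊎ ∃₂ λ a b → R a b × γ ≈ a × α ≈ b

  R⇒≤ᴿ : ∀ {a b} → R a b → a ≤ᴿ b
  R⇒≤ᴿ {a} {b} aRb = inj₂ (a , b , aRb , ≈-refl , ≈-refl)

  ≤ᴿ-trans : ∀ {γ δ α} → γ ≤ᴿ δ → δ ≤ᴿ α → γ ≤ᴿ α
  ≤ᴿ-trans (inj₁ γ≈δ) (inj₁ δ≈α) = inj₁ (≈-trans γ≈δ δ≈α)
  ≤ᴿ-trans (inj₁ γ≈δ) (inj₂ (a , b , aRb , δ≈a , α≈b)) =
    inj₂ (a , b , aRb , ≈-trans γ≈δ δ≈a , α≈b)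
  ≤ᴿ-trans (inj₂ (a , b , aRb , γ≈a , δ≈b)) (inj₁ δ≈α) =
    inj₂ (a , b , aRb , γ≈a , ≈-trans (≈-sym δ≈α) δ≈b)
  ≤ᴿ-trans (inj₂ (a , b , aRb , γ≈a , δ≈b)) (inj₂ (a′ , b′ , a′Rb′ , δ≈a′ , α≈b′)) =
    inj₂ (a , b′ , R-trans-≈ aRb (≈-trans (≈-sym δ≈b) δ≈a′) a′Rb′ , γ≈a , α≈b′)

  ≤ᴿ-antisym : ∀ {α β} → α ≤ᴿ β → β ≤ᴿ α → α ≈ β
  ≤ᴿ-antisym (inj₁ α≈β) _          = α≈β
  ≤ᴿ-antisym (inj₂ _)   (inj₁ β≈α) = ≈-sym β≈α
  ≤ᴿ-antisym (inj₂ (a , b , aRb , α≈a , β≈b)) (inj₂ (a′ , b′ , a′Rb′ , β≈a′ , α≈b′)) =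
    contradiction (≈-trans (≈-sym α≈a) α≈b′)
                  (R⇒≉ (R-trans-≈ aRb (≈-trans (≈-sym β≈b) β≈a′) a′Rb′))

  ≤ᴿ-isPartialOrder : IsPartialOrder _≈_ _≤ᴿ_
  ≤ᴿ-isPartialOrder = record
    { isPreorder = record
      { isEquivalence = ≈-isEquivalence
      ; reflexive     = inj₁
      ; trans         = ≤ᴿ-trans
      }
    ; antisym = ≤ᴿ-antisym
    }

∼-isEquivalence : IsEquivalence _∼_
∼-isEquivalence = record
  { refl  = λ _ → refl
  ; sym   = λ α∼β v → ≡.sym (α∼β v)
  ; trans = λ α∼β β∼γ v → ≡.trans (α∼β v) (β∼γ v)
  }

∼-setoid : Setoid 0ℓ 0ℓ
∼-setoid = record { isEquivalence = ∼-isEquivalence }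

regularLinearExtension : ExcludedMiddle 0ℓ → {_⊑_ : Rel Sen 0ℓ} → IsPartialOrder _∼_ _⊑_ →
  Σ (Sen → Sen → Set) λ _<_ →
    IsRegularTotalOrdering _<_ × (∀ {α β} → α ⊑ β → ¬ α ∼ β → α < β)
regularLinearExtension lem isPartialOrder =
  _≺_ , (≺-isStrictTotalOrder , ≺-regular) , ⊏⇒≺
  where open LinearExtension lem encode-injective isPartialOrder

proposition2p33 : ExcludedMiddle 0ℓ →
    Σ (Sen → Sen → Set) IsRegularTotalOrdering ×
    (∀ (A : Sen → Set) (R : Sen → Sen → Set) →
      PairwiseInequivalent A → IsPartialOrderingOf A R →
      Σ (Sen → Sen → Set) λ _<_ →
        IsRegularTotalOrdering _<_ × (∀ α β → R α β → α < β))
proposition2p33 lem =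
  map₂ proj₁ (regularLinearExtension lem ≈-isPartialOrder) , extendingR
  where
  open SetoidProperties ∼-setoid using (≈-isPartialOrder)
  extendingR : ∀ A R → PairwiseInequivalent A → IsPartialOrderingOf A R →
    Σ (Sen → Sen → Set) λ _<_ → IsRegularTotalOrdering _<_ × (∀ α β → R α β → α < β)
  extendingR A R inequivalent (domain , irrefl , trans) =
    map₂ (map₂ λ extends α β αRβ → extends (R⇒≤ᴿ αRβ) (R⇒≉ αRβ))
         (regularLinearExtension lem ≤ᴿ-isPartialOrder)
    where
    ∼⇒≡-on-A : ∀ {α β} → A α → A β → α ∼ β → α ≡ β
    ∼⇒≡-on-A {α} {β} Aα Aβ α∼β = Classical.dne lem (λ α≢β → inequivalent α β Aα Aβ α≢β α∼β)
    open ClosureUnderEquivalence ∼-isEquivalence A ∼⇒≡-on-A R domain irrefl trans
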